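{- For every set $\Gamma$ of formulas of $\mathcal{L}_{\mathsf{DPL}}$ and all formulas $\varphi,\psi$, we have $\Gamma\cup\{\varphi\}\vdash\psi$ if and only if $\Gamma\vdash\varphi\to\psi$, where $\vdash$ is derivability in $\mathcal{H}^{ - }_{\mathsf{DPL}}$.
   Context: Let $\mathbb{P}$ be a countable set of propositional variables. The formulas of $\mathcal{L}_{\mathsf{DPL}}$ are given by $\varphi ::= p \mid \neg\varphi \mid \varphi\wedge\varphi \mid L_r\varphi \mid \bigcirc\varphi$ with $p\in\mathbb{P}$, $r\in\mathbb{Q}\cap[0,1]$; other Boolean connectives are abbreviations, $\bigcirc^n$ is $n$-fold iteration of $\bigcirc$. The Hilbert system $\mathcal{H}^{ - }_{\mathsf{DPL}}$ has the axiom schemes: all propositional tautologies; $L_0\bot$; $L_r\neg\varphi\to\neg L_s\varphi$ if $r+s>1$; $L_r(\varphi\wedge\psi)\wedge L_s(\varphi\wedge\neg\psi)\to L_{r+s}\varphi$ if $r+s\le 1$; $\neg L_r(\varphi\wedge\psi)\wedge\neg L_s(\varphi\wedge\neg\psi)\to\neg L_{r+s}\varphi$ if $r+s\le1$; $L_1(\varphi\to\psi)\to(L_r\varphi\to L_r\psi)$; $\bigcirc\neg\varphi\leftrightarrow\neg\bigcirc\varphi$; $\bigcirc(\varphi\wedge\psi)\leftrightarrow(\bigcirc\varphi\wedge\bigcirc\psi)$; and the rules: modus ponens; the Archimedean rule: from $\{\psi\to\bigcirc^nL_s\varphi \mid s<r,\ s\in\mathbb{Q}\cap[0,1]\}$ infer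 $\psi\to\bigcirc^nL_r\varphi$ (each $n\in\mathbb{N}$); necessitation: from $\varphi$ infer $L_1\varphi$; from $\varphi$ infer $\bigcirc\varphi$. A theorem ($\vdash\varphi$) is the last element of a sequence $(\varphi_\beta)_{\beta\le\alpha+1}$, $\alpha$ a countable ordinal, each element being an axiom or obtained by a rule from (possibly infinitely many) earlier elements. $\Gamma\vdash\varphi$ means there is such a sequence ending in $\varphi$ each element of which is a member of $\Gamma$, a theorem, or obtained from earlier elements by a rule other than the two necessitation rules. -}

module Defs where

open import Data.Nat using (ℕ; zero; suc)
open import Data.Bool using (Bool; true; false; not; _∧_)
open import Data.Rational using (ℚ; 0ℚ; 1ℚ; _+_; _≤_; _<_)
open import Data.Rational.Properties using (+-mono-≤; +-identityˡ)
open import Data.Product using (_×_)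
open import Data.Sum using (_⊎_)
open import Relation.Binary.PropositionalEquality using (_≡_; subst)

-- The index r of L_r ranges over ℚ ∩ [0,1]; the bounds are irrelevant
-- arguments, so two formulas L_r φ are equal iff their r and φ are.

data Formula : Set where
  var  : ℕ → Formula
  ¬'_  : Formula → Formula
  _∧'_ : Formula → Formula → Formula
  L    : (r : ℚ) → .(0ℚ ≤ r) → .(r ≤ 1ℚ) → Formula → Formula
  ○_   : Formula → Formula

infixr 30 ¬'_ ○_
infixr 25 _∧'_
infixr 20 _⇒'_ _⇔'_

_⇒'_ : Formula → Formula → Formula
φ ⇒' ψ = ¬' (φ ∧' ¬' ψ)

_⇔'_ : Formula → Formula → Formula
φ ⇔' ψ = (φ ⇒' ψ) ∧' (ψ ⇒' φ)

⊥' : Formula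
⊥' = var 0 ∧' ¬' var 0

○^ : ℕ → Formula → Formula
○^ zero    φ = φ
○^ (suc n) φ = ○ (○^ n φ)

0≤1 : 0ℚ ≤ 1ℚ
0≤1 = Data.Rational.*≤* (Data.Integer.+≤+ Data.Nat.z≤n)
  where import Data.Integer; import Data.Nat

0≤+ : ∀ {r s} → 0ℚ ≤ r → 0ℚ ≤ s → 0ℚ ≤ r + s
0≤+ {r} {s} p q = subst (_≤ r + s) (+-identityˡ 0ℚ) (+-mono-≤ p q)

-- Propositional tautologies: formulas true under every Boolean valuation
-- in which variables, L_r-formulas and ○-formulas are treated as atoms.

eval : (Formula → Bool) → Formula → Bool
eval v (var p)       = v (var p)
eval v (¬' φ)        = not (eval v φ)
eval v (φ ∧' ψ)      = eval v φ ∧ eval v ψ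
eval v (L r p q φ)   = v (L r p q φ)
eval v (○ φ)         = v (○ φ)

Tautology : Formula → Set
Tautology φ = (v : Formula → Bool) → eval v φ ≡ true

data Axiom : Formula → Set where
  taut   : ∀ {φ} → Tautology φ → Axiom φ
  L0⊥    : Axiom (L 0ℚ (Data.Rational.Properties.≤-refl) 0≤1 ⊥')
  neg    : ∀ {φ} r s (r0 : 0ℚ ≤ r) (r1 : r ≤ 1ℚ) (s0 : 0ℚ ≤ s) (s1 : s ≤ 1ℚ) →
           1ℚ < r + s →
           Axiom (L r r0 r1 (¬' φ) ⇒' ¬' L s s0 s1 φ)
  add    : ∀ {φ ψ} r s (r0 : 0ℚ ≤ r) (r1 : r ≤ 1ℚ) (s0 : 0ℚ ≤ s) (s1 : s ≤ 1ℚ) →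
           (rs1 : r + s ≤ 1ℚ) →
           Axiom ((L r r0 r1 (φ ∧' ψ) ∧' L s s0 s1 (φ ∧' ¬' ψ))
                    ⇒' L (r + s) (0≤+ r0 s0) rs1 φ)
  addNeg : ∀ {φ ψ} r s (r0 : 0ℚ ≤ r) (r1 : r ≤ 1ℚ) (s0 : 0ℚ ≤ s) (s1 : s ≤ 1ℚ) →
           (rs1 : r + s ≤ 1ℚ) →
           Axiom ((¬' L r r0 r1 (φ ∧' ψ) ∧' ¬' L s s0 s1 (φ ∧' ¬' ψ))
                    ⇒' ¬' L (r + s) (0≤+ r0 s0) rs1 φ)
  K      : ∀ {φ ψ} r (r0 : 0ℚ ≤ r) (r1 : r ≤ 1ℚ) →
           Axiom (L 1ℚ 0≤1 (Data.Rational.Properties.≤-refl) (φ ⇒' ψ)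
                    ⇒' (L r r0 r1 φ ⇒' L r r0 r1 ψ))
  ○¬     : ∀ {φ} → Axiom (○ ¬' φ ⇔' ¬' ○ φ)
  ○∧     : ∀ {φ ψ} → Axiom (○ (φ ∧' ψ) ⇔' (○ φ ∧' ○ ψ))

-- Theorems (⊢ φ): well-founded, possibly infinitely branching derivation
-- trees (equivalent to countable-ordinal-length derivation sequences).

data ⊢_ : Formula → Set where
  ax   : ∀ {φ} → Axiom φ → ⊢ φ
  mp   : ∀ {φ ψ} → ⊢ φ → ⊢ (φ ⇒' ψ) → ⊢ ψ
  arch : ∀ {φ ψ} n r (r0 : 0ℚ ≤ r) (r1 : r ≤ 1ℚ) →
         ((s : ℚ) (s0 : 0ℚ ≤ s) (s1 : s ≤ 1ℚ) → s < r →
            ⊢ (ψ ⇒' ○^ n (L s s0 s1 φ))) →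
         ⊢ (ψ ⇒' ○^ n (L r r0 r1 φ))
  necL : ∀ {φ} → ⊢ φ → ⊢ L 1ℚ 0≤1 (Data.Rational.Properties.≤-refl) φ
  nec○ : ∀ {φ} → ⊢ φ → ⊢ (○ φ)

FormulaSet : Set₁
FormulaSet = Formula → Set

_∪｛_｝ : FormulaSet → Formula → FormulaSet
(Γ ∪｛ φ ｝) χ = Γ χ ⊎ χ ≡ φ

data _⊢_ (Γ : FormulaSet) : Formula → Set where
  hyp  : ∀ {φ} → Γ φ → Γ ⊢ φ
  thm  : ∀ {φ} → ⊢ φ → Γ ⊢ φ
  mp   : ∀ {φ ψ} → Γ ⊢ φ → Γ ⊢ (φ ⇒' ψ) → Γ ⊢ ψ
  arch : ∀ {φ ψ} n r (r0 : 0ℚ ≤ r) (r1 : r ≤ 1ℚ) →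
         ((s : ℚ) (s0 : 0ℚ ≤ s) (s1 : s ≤ 1ℚ) → s < r →
            Γ ⊢ (ψ ⇒' ○^ n (L s s0 s1 φ))) →
         Γ ⊢ (ψ ⇒' ○^ n (L r r0 r1 φ))

infix 10 ⊢_ _⊢_

-- Prefix every formula of a derivation from Γ ∪ {φ} with φ ⇒'. Hypotheses,
-- theorems and modus ponens steps are handled by propositional tautologies.
-- The Archimedean rule survives because its premises and conclusion already
-- carry an arbitrary antecedent ψ, into which φ is absorbed as φ ∧' ψ. The
-- argument relies on Γ ⊢ excluding the necessitation rules, which would not
-- commute with the prefix φ ⇒'.
module Submission where

open import Defs
open import Data.Bool using (Bool; true; false; not; _∧_)
open import Data.Product using (_×_; _,_)
open import Data.Sum using (inj₁; inj₂)
open import Relation.Binary.PropositionalEquality using (_≡_; refl)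

-- eval v (φ ⇒' ψ) reduces to eval v φ ⇒ᵇ eval v ψ.
_⇒ᵇ_ : Bool → Bool → Bool
a ⇒ᵇ b = not (a ∧ not b)

infixr 20 _⇒ᵇ_

⇒ᵇ-refl : ∀ a → a ⇒ᵇ a ≡ true
⇒ᵇ-refl false = refl
⇒ᵇ-refl true  = refl

⇒ᵇ-const : ∀ a b → b ⇒ᵇ a ⇒ᵇ b ≡ true
⇒ᵇ-const a     false = refl
⇒ᵇ-const false true  = refl
⇒ᵇ-const true  true  = refl

⇒ᵇ-S : ∀ f a b → (f ⇒ᵇ a) ⇒ᵇ (f ⇒ᵇ a ⇒ᵇ b) ⇒ᵇ f ⇒ᵇ b ≡ true
⇒ᵇ-S false a     b     = refl
⇒ᵇ-S true  false b     = refl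
⇒ᵇ-S true  true  false = refl
⇒ᵇ-S true  true  true  = refl

⇒ᵇ-uncurry : ∀ a b c → (a ⇒ᵇ b ⇒ᵇ c) ⇒ᵇ (a ∧ b) ⇒ᵇ c ≡ true
⇒ᵇ-uncurry false b     c     = refl
⇒ᵇ-uncurry true  false c     = refl
⇒ᵇ-uncurry true  true  false = refl
⇒ᵇ-uncurry true  true  true  = refl

⇒ᵇ-curry : ∀ a b c → ((a ∧ b) ⇒ᵇ c) ⇒ᵇ a ⇒ᵇ b ⇒ᵇ c ≡ true
⇒ᵇ-curry false b     c     = refl
⇒ᵇ-curry true  false c     = refl
⇒ᵇ-curry true  true  false = refl
⇒ᵇ-curry true  true  true  = refl

module _ {Γ : FormulaSet} where

  ⊢-tautology : ∀ {φ} → Tautology φ → Γ ⊢ φ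
  ⊢-tautology t = thm (ax (taut t))

  ⇒-refl : ∀ {φ} → Γ ⊢ φ ⇒' φ
  ⇒-refl {φ} = ⊢-tautology λ v → ⇒ᵇ-refl (eval v φ)

  ⇒-const : ∀ {φ χ} → Γ ⊢ χ → Γ ⊢ φ ⇒' χ
  ⇒-const {φ} {χ} d = mp d (⊢-tautology λ v → ⇒ᵇ-const (eval v φ) (eval v χ))

  ⇒-mp : ∀ {φ χ θ} → Γ ⊢ φ ⇒' χ → Γ ⊢ φ ⇒' χ ⇒' θ → Γ ⊢ φ ⇒' θ
  ⇒-mp {φ} {χ} {θ} d e =
    mp e (mp d (⊢-tautology λ v → ⇒ᵇ-S (eval v φ) (eval v χ) (eval v θ)))

  ⇒-uncurry : ∀ {φ χ θ} → Γ ⊢ φ ⇒' χ ⇒' θ → Γ ⊢ (φ ∧' χ) ⇒' θ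
  ⇒-uncurry {φ} {χ} {θ} d =
    mp d (⊢-tautology λ v → ⇒ᵇ-uncurry (eval v φ) (eval v χ) (eval v θ))

  ⇒-curry : ∀ {φ χ θ} → Γ ⊢ (φ ∧' χ) ⇒' θ → Γ ⊢ φ ⇒' χ ⇒' θ
  ⇒-curry {φ} {χ} {θ} d =
    mp d (⊢-tautology λ v → ⇒ᵇ-curry (eval v φ) (eval v χ) (eval v θ))

⊢-mono : ∀ {Γ Δ χ} → (∀ {θ} → Γ θ → Δ θ) → Γ ⊢ χ → Δ ⊢ χ
⊢-mono Γ⊆Δ (hyp γ)              = hyp (Γ⊆Δ γ)
⊢-mono Γ⊆Δ (thm d)              = thm d
⊢-mono Γ⊆Δ (mp d e)             = mp (⊢-mono Γ⊆Δ d) (⊢-mono Γ⊆Δ e)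
⊢-mono Γ⊆Δ (arch n r r0 r1 ds) =
  arch n r r0 r1 λ s s0 s1 s<r → ⊢-mono Γ⊆Δ (ds s s0 s1 s<r)

deduction : ∀ {Γ φ χ} → (Γ ∪｛ φ ｝) ⊢ χ → Γ ⊢ φ ⇒' χ
deduction (hyp (inj₁ γ))      = ⇒-const (hyp γ)
deduction (hyp (inj₂ refl))   = ⇒-refl
deduction (thm d)             = ⇒-const (thm d)
deduction (mp d e)            = ⇒-mp (deduction d) (deduction e)
deduction (arch n r r0 r1 ds) =
  ⇒-curry (arch n r r0 r1 λ s s0 s1 s<r → ⇒-uncurry (deduction (ds s s0 s1 s<r)))

deduction⁻¹ : ∀ {Γ φ χ} → Γ ⊢ φ ⇒' χ → (Γ ∪｛ φ ｝) ⊢ χ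
deduction⁻¹ d = mp (hyp (inj₂ refl)) (⊢-mono inj₁ d)

theorem2p9 : (Γ : FormulaSet) (φ ψ : Formula) →
    ((Γ ∪｛ φ ｝) ⊢ ψ → Γ ⊢ (φ ⇒' ψ)) × (Γ ⊢ (φ ⇒' ψ) → (Γ ∪｛ φ ｝) ⊢ ψ)
theorem2p9 Γ φ ψ = deduction , deduction⁻¹
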